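{- For every $n\ge3$, the optimal rubbling number of the cycle $C_n$ is $\rho_{\mathrm{opt}}(C_n)=\left\lceil\frac{n}{2}\right\rceil$.
   Context: A pebble distribution on a graph $G$ is a function $p:V(G)\to\mathbb{Z}_{\ge0}$, its size is $\sum_v p(v)$. If $\{v,u\}\in E(G)$, the pebbling move $(v,v\to u)$ removes two pebbles at $v$ and adds one at $u$. If $v\ne w$ and $\{v,u\},\{w,u\}\in E(G)$, the strict rubbling move $(v,w\to u)$ removes one pebble at each of $v$ and $w$ and adds one at $u$. A rubbling move is either of these. A vertex $x$ is reachable from $p$ if there is a sequence of rubbling moves, with pebble counts never becoming negative, after which $x$ has at least one pebble. The optimal rubbling number $\rho_{\mathrm{opt}}(G)$ is the minimum $m$ for which there exists a pebble distribution of size $m$ from which every vertex of $G$ is reachable. -}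

module Defs where

open import Data.Nat using (ℕ; zero; suc; _+_; _*_; _≤_; ⌈_/2⌉)
open import Data.Fin using (Fin; toℕ; _≟_)
open import Data.Bool using (if_then_else_)
open import Data.Sum using (_⊎_)
open import Data.Product using (Σ; ∃; _×_; _,_)
open import Data.Vec.Functional using (foldr)
open import Relation.Nullary using (¬_)
open import Relation.Nullary.Decidable using (⌊_⌋)
open import Relation.Binary.PropositionalEquality using (_≡_)
open import Relation.Binary.Construct.Closure.ReflexiveTransitive using (Star)

record Graph : Set₁ where
  field
    n   : ℕ
    Adj : Fin n → Fin n → Set
open Graph public

Distribution : Graph → Set
Distribution G = Fin (n G) → ℕ

size : (G : Graph) → Distribution G → ℕ
size G p = foldr _+_ 0 p

𝟙 : ∀ {k} → Fin k → Fin k → ℕ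
𝟙 x v = if ⌊ x ≟ v ⌋ then 1 else 0

-- One rubbling move transforming p into q.  The pointwise equation
--   q x + (pebbles removed at x) ≡ p x + (pebbles added at x)
-- determines q and enforces that counts never become negative.
data Move (G : Graph) (p q : Distribution G) : Set where
  pebbling : (v u : Fin (n G)) → Adj G v u →
             (∀ x → q x + 2 * 𝟙 x v ≡ p x + 𝟙 x u) → Move G p q
  strict   : (v w u : Fin (n G)) → ¬ (v ≡ w) → Adj G v u → Adj G w u →
             (∀ x → q x + 𝟙 x v + 𝟙 x w ≡ p x + 𝟙 x u) → Move G p q

Reachable : (G : Graph) → Distribution G → Fin (n G) → Set
Reachable G p x = ∃ λ q → Star (Move G) p q × 1 ≤ q x

Solvable : (G : Graph) → Distribution G → Set
Solvable G p = ∀ x → Reachable G p x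

IsOptRubblingNumber : Graph → ℕ → Set
IsOptRubblingNumber G m =
  (Σ (Distribution G) λ p → size G p ≡ m × Solvable G p) ×
  (∀ p → Solvable G p → m ≤ size G p)

CycSucc : (k : ℕ) → Fin k → Fin k → Set
CycSucc k i j = (suc (toℕ i) ≡ toℕ j) ⊎ (suc (toℕ i) ≡ k × toℕ j ≡ 0)

CycleAdj : (k : ℕ) → Fin k → Fin k → Set
CycleAdj k i j = CycSucc k i j ⊎ CycSucc k j i

Cycle : ℕ → Graph
Cycle k = record { n = k ; Adj = CycleAdj k }

-- Upper bound: put one pebble on every even-numbered vertex; each remaining vertex has two
-- pebbled neighbours and is reached by one strict rubbling move.
-- Lower bound: list the pebbles on the other vertices, from the successor of x around to its
-- predecessor, as arm. Pebbling can gather at most load arm pebbles on one neighbour of x and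
-- load (reverse arm) on the other; a move avoiding x only lowers these loads, and a move
-- involving x needs a pebble at x or enough at its neighbours. So a reachable x is covered:
-- it holds a pebble or the two loads supply 2 or 1 + 1. When every vertex is covered, merging a
-- pebbled vertex with its two neighbours keeps all vertices covered, removes two vertices and one
-- pebble, and induction on the length of the cycle gives at least ⌈ n /2⌉ pebbles.

module Submission where

open import Defs
open import Data.Fin as F using (Fin; toℕ)
open import Data.Fin.Properties using (toℕ-fromℕ<; toℕ-injective; toℕ<n)
open import Data.List using (List; []; _∷_; _++_; _∷ʳ_; reverse; length; applyUpTo)
open import Data.List.Properties
  using (∷-injective; ++-assoc; ++-identityʳ; reverse-++; unfold-reverse; reverse-applyUpTo; length-applyUpTo)
open import Data.List.Relation.Binary.Permutation.Propositional using (_↭_; ↭-trans)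
open import Data.List.Relation.Binary.Permutation.Propositional.Properties using (↭-reverse; ++-comm; ↭-length)
open import Data.Nat
  using (ℕ; NonZero; zero; suc; _+_; _*_; _∸_; _≤_; _<_; _≥_; z≤n; s≤s; s≤s⁻¹; z<s; s<s; ⌊_/2⌋; ⌈_/2⌉)
open import Data.Nat.DivMod using (_mod_; _%_; m%n<n; %-distribˡ-+; m%n%n≡m%n; [m+n]%n≡m%n; m<n⇒m%n≡m; n%n≡0)
open import Data.Nat.ListAction using (sum)
open import Data.Nat.ListAction.Properties using (sum-↭)
open import Data.Nat.Properties
open import Data.Nat.Tactic.RingSolver using (solve-∀)
open import Data.Product using (∃-syntax; _×_; _,_)
open import Data.Sum using (_⊎_; inj₁; inj₂)
open import Data.Vec.Functional using (foldr)
open import Function using (_∘_)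
open import Relation.Binary.Construct.Closure.ReflexiveTransitive using (Star; ε; _◅_)
open import Relation.Binary.PropositionalEquality
open import Relation.Nullary using (¬_; yes; no; contradiction)
open import Algebra.Properties.CommutativeSemigroup +-commutativeSemigroup using (xy∙z≈xz∙y)

-- Loads and covered cyclic sequences

-- load as: the pebbles that pebbling moves can gather on the first vertex of a path carrying as.
load : List ℕ → ℕ
load []       = 0
load (a ∷ as) = a + ⌊ load as /2⌋

Suffices : ℕ → ℕ → Set
Suffices r l = 2 ≤ r ⊎ 2 ≤ l ⊎ (1 ≤ r × 1 ≤ l)

-- A vertex with y pebbles on a cycle whose remaining vertices, read around the cycle from its
-- successor, carry arm; load arm and load (reverse arm) bound the supply at its two neighbours.
Covered : ℕ → List ℕ → Set
Covered y arm = 1 ≤ y ⊎ Suffices (load arm) (load (reverse arm))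

CyclicallyCovered : List ℕ → Set
CyclicallyCovered L = ∀ as y bs → L ≡ as ++ y ∷ bs → Covered y (bs ++ as)

infix 4 _≼_
_≼_ : List ℕ → List ℕ → Set
xs ≼ ys = load xs ≤ load ys × load (reverse xs) ≤ load (reverse ys)

Suffices-mono : ∀ {r l r′ l′} → r ≤ r′ → l ≤ l′ → Suffices r l → Suffices r′ l′
Suffices-mono r≤r′ l≤l′ (inj₁ 2≤r)               = inj₁ (≤-trans 2≤r r≤r′)
Suffices-mono r≤r′ l≤l′ (inj₂ (inj₁ 2≤l))        = inj₂ (inj₁ (≤-trans 2≤l l≤l′))
Suffices-mono r≤r′ l≤l′ (inj₂ (inj₂ (1≤r , 1≤l))) = inj₂ (inj₂ (≤-trans 1≤r r≤r′ , ≤-trans 1≤l l≤l′))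

Covered-mono : ∀ {y xs ys} → xs ≼ ys → Covered y xs → Covered y ys
Covered-mono _                (inj₁ 1≤y) = inj₁ 1≤y
Covered-mono (r≤r′ , l≤l′) (inj₂ s)   = inj₂ (Suffices-mono r≤r′ l≤l′ s)

load-++-monoʳ : ∀ xs {ys zs} → load ys ≤ load zs → load (xs ++ ys) ≤ load (xs ++ zs)
load-++-monoʳ []       le = le
load-++-monoʳ (x ∷ xs) le = +-monoʳ-≤ x (⌊n/2⌋-mono (load-++-monoʳ xs le))

load≤sum : ∀ xs → load xs ≤ sum xs
load≤sum []       = z≤n
load≤sum (x ∷ xs) = +-monoʳ-≤ x (≤-trans (⌊n/2⌋≤n (load xs)) (load≤sum xs))

reverse-++₃ : ∀ {A : Set} (xs ys zs : List A) → reverse (xs ++ ys ++ zs) ≡ reverse zs ++ reverse ys ++ reverse xs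
reverse-++₃ xs ys zs = begin
  reverse (xs ++ ys ++ zs)             ≡⟨ reverse-++ xs (ys ++ zs) ⟩
  reverse (ys ++ zs) ++ reverse xs     ≡⟨ cong (_++ reverse xs) (reverse-++ ys zs) ⟩
  (reverse zs ++ reverse ys) ++ reverse xs ≡⟨ ++-assoc (reverse zs) (reverse ys) (reverse xs) ⟩
  reverse zs ++ reverse ys ++ reverse xs ∎
  where open ≡-Reasoning

≼-middle : ∀ bs {xs ys} as →
           (∀ cs → load (xs ++ cs) ≤ load (ys ++ cs)) →
           (∀ cs → load (reverse xs ++ cs) ≤ load (reverse ys ++ cs)) →
           bs ++ xs ++ as ≼ bs ++ ys ++ as
≼-middle bs {xs} {ys} as fwd bwd =
  load-++-monoʳ bs (fwd as) ,
  subst₂ _≤_ (cong load (sym (reverse-++₃ bs xs as))) (cong load (sym (reverse-++₃ bs ys as)))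
    (load-++-monoʳ (reverse as) (bwd (reverse bs)))

load-contract : ∀ u v w cs → load (u ∷ suc v ∷ w ∷ cs) ≤ load (u + v + w ∷ cs)
load-contract u v w cs = begin
  u + ⌊ suc v + ⌊ w + c /2⌋ /2⌋ ≤⟨ +-monoʳ-≤ u (s≤s⁻¹ (⌊n/2⌋<n (v + ⌊ w + c /2⌋))) ⟩
  u + (v + ⌊ w + c /2⌋)         ≤⟨ +-monoʳ-≤ u (+-monoʳ-≤ v (⌊n/2⌋≤n (w + c))) ⟩
  u + (v + (w + c))             ≡⟨ sym (trans (+-assoc (u + v) w c) (+-assoc u v (w + c))) ⟩
  u + v + w + c                 ∎
  where
  open ≤-Reasoning
  c = ⌊ load cs /2⌋

≼-contract : ∀ bs u v w as → bs ++ u ∷ suc v ∷ w ∷ as ≼ bs ++ u + v + w ∷ as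
≼-contract bs u v w as = ≼-middle bs as (load-contract u v w) backward
  where
  backward : ∀ cs → load (w ∷ suc v ∷ u ∷ cs) ≤ load (u + v + w ∷ cs)
  backward cs = subst (λ t → load (w ∷ suc v ∷ u ∷ cs) ≤ load (t ∷ cs))
                      (trans (trans (+-comm (w + v) u) (cong (u +_) (+-comm w v))) (sym (+-assoc u v w)))
                      (load-contract w v u cs)

Covered-head : ∀ y bs → CyclicallyCovered (y ∷ bs) → Covered y bs
Covered-head y bs cc = subst (Covered y) (++-identityʳ bs) (cc [] y bs refl)

Suffices-positive : ∀ {r l} → Suffices r l → 1 ≤ r ⊎ 1 ≤ l
Suffices-positive (inj₁ 2≤r)             = inj₁ (≤-trans (s≤s z≤n) 2≤r)
Suffices-positive (inj₂ (inj₁ 2≤l))      = inj₂ (≤-trans (s≤s z≤n) 2≤l)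
Suffices-positive (inj₂ (inj₂ (1≤r , _))) = inj₁ 1≤r

CyclicallyCovered⇒1≤sum : ∀ L → CyclicallyCovered L → 1 ≤ length L → 1 ≤ sum L
CyclicallyCovered⇒1≤sum (y ∷ bs) cc _ with Covered-head y bs cc
... | inj₁ 1≤y = ≤-trans 1≤y (m≤m+n y (sum bs))
... | inj₂ s with Suffices-positive s
...   | inj₁ 1≤r = ≤-trans (≤-trans 1≤r (load≤sum bs)) (m≤n+m (sum bs) y)
...   | inj₂ 1≤l = ≤-trans (≤-trans 1≤l (load≤sum (reverse bs)))
                           (≤-trans (≤-reflexive (sum-↭ (↭-reverse bs))) (m≤n+m (sum bs) y))

split-++≡++∷ : ∀ {A : Set} (bs as cs : List A) x ds → bs ++ as ≡ cs ++ x ∷ ds →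
  (∃[ e ] bs ≡ cs ++ x ∷ e × ds ≡ e ++ as) ⊎ (∃[ e ] cs ≡ bs ++ e × as ≡ e ++ x ∷ ds)
split-++≡++∷ []       as cs       x ds eq = inj₂ (cs , refl , eq)
split-++≡++∷ (b ∷ bs) as []       x ds eq with ∷-injective eq
... | refl , eq′ = inj₁ (bs , refl , sym eq′)
split-++≡++∷ (b ∷ bs) as (c ∷ cs) x ds eq with ∷-injective eq
... | refl , eq′ with split-++≡++∷ bs as cs x ds eq′
...   | inj₁ (e , p , q) = inj₁ (e , cong (b ∷_) p , q)
...   | inj₂ (e , p , q) = inj₂ (e , cong (b ∷_) p , q)

CyclicallyCovered-rotate : ∀ as bs → CyclicallyCovered (as ++ bs) → CyclicallyCovered (bs ++ as)
CyclicallyCovered-rotate as bs cc cs x ds eq with split-++≡++∷ bs as cs x ds eq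
... | inj₁ (e , refl , refl) =
  subst (Covered x) (sym (++-assoc e as cs)) (cc (as ++ cs) x e (sym (++-assoc as cs (x ∷ e))))
... | inj₂ (e , refl , refl) =
  subst (Covered x) (++-assoc ds bs e) (cc e x (ds ++ bs) (++-assoc e (x ∷ ds) bs))

1≤⌊⌊n/2⌋/2⌋⇒2≤n : ∀ n → 1 ≤ ⌊ ⌊ n /2⌋ /2⌋ → 2 ≤ n
1≤⌊⌊n/2⌋/2⌋⇒2≤n (suc (suc n)) _ = s≤s (s≤s z≤n)

Suffices-between : ∀ r l → Suffices (1 + ⌊ ⌊ r /2⌋ /2⌋) l → Suffices r (1 + ⌊ ⌊ l /2⌋ /2⌋) → Suffices r l
Suffices-between r l (inj₁ (s≤s 1≤q))        _                       = inj₁ (1≤⌊⌊n/2⌋/2⌋⇒2≤n r 1≤q)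
Suffices-between r l (inj₂ (inj₁ 2≤l))       _                       = inj₂ (inj₁ 2≤l)
Suffices-between r l (inj₂ (inj₂ (_ , 1≤l))) (inj₁ 2≤r)              = inj₁ 2≤r
Suffices-between r l (inj₂ (inj₂ (_ , 1≤l))) (inj₂ (inj₁ (s≤s 1≤q))) = inj₂ (inj₁ (1≤⌊⌊n/2⌋/2⌋⇒2≤n l 1≤q))
Suffices-between r l (inj₂ (inj₂ (_ , 1≤l))) (inj₂ (inj₂ (1≤r , _))) = inj₂ (inj₂ (1≤r , 1≤l))

load-++-0∷1 : ∀ xs → load (xs ++ 0 ∷ 1 ∷ []) ≤ load xs
load-++-0∷1 xs = subst (load (xs ++ 0 ∷ 1 ∷ []) ≤_) (cong load (++-identityʳ xs)) (load-++-monoʳ xs z≤n)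

Covered-empty : ∀ arm → Covered 0 arm → Suffices (load arm) (load (reverse arm))
Covered-empty _ (inj₂ s) = s

Covered-merged-centre : ∀ rest → CyclicallyCovered (0 ∷ 1 ∷ 0 ∷ rest) → Covered 0 rest
Covered-merged-centre rest cc = inj₂ (Suffices-between (load rest) (load (reverse rest)) left right)
  where
  left : Suffices (load (1 ∷ 0 ∷ rest)) (load (reverse rest))
  left = Suffices-mono ≤-refl
           (subst (λ xs → load xs ≤ load (reverse rest)) (sym (reverse-++ (1 ∷ 0 ∷ []) rest))
             (load-++-0∷1 (reverse rest)))
           (Covered-empty (1 ∷ 0 ∷ rest) (Covered-head 0 (1 ∷ 0 ∷ rest) cc))
  right : Suffices (load rest) (load (1 ∷ 0 ∷ reverse rest))
  right = Suffices-mono (load-++-0∷1 rest) (≤-reflexive (cong load (reverse-++ rest (0 ∷ 1 ∷ []))))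
            (Covered-empty (rest ++ 0 ∷ 1 ∷ []) (cc (0 ∷ 1 ∷ []) 0 rest refl))

CyclicallyCovered-contract : ∀ u v w rest → CyclicallyCovered (u ∷ suc v ∷ w ∷ rest) →
                             CyclicallyCovered (u + v + w ∷ rest)
CyclicallyCovered-contract u v w rest cc (z ∷ as) y bs eq with ∷-injective eq
... | refl , eq′ =
  Covered-mono {xs = bs ++ u ∷ suc v ∷ w ∷ as} {ys = bs ++ u + v + w ∷ as} (≼-contract bs u v w as)
    (cc (u ∷ suc v ∷ w ∷ as) y bs (cong (λ xs → u ∷ suc v ∷ w ∷ xs) eq′))
CyclicallyCovered-contract u v w rest cc [] y bs eq with ∷-injective eq
... | refl , refl = subst (Covered (u + v + w)) (sym (++-identityʳ rest)) (centre u v w cc)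
  where
  centre : ∀ u v w → CyclicallyCovered (u ∷ suc v ∷ w ∷ rest) → Covered (u + v + w) rest
  centre (suc u) v       w       _  = inj₁ (s≤s z≤n)
  centre zero    (suc v) w       _  = inj₁ (s≤s z≤n)
  centre zero    zero    (suc w) _  = inj₁ (s≤s z≤n)
  centre zero    zero    zero    cc = Covered-merged-centre rest cc

positive-entry : ∀ L → 1 ≤ sum L → ∃[ as ] ∃[ v ] ∃[ bs ] L ≡ as ++ suc v ∷ bs
positive-entry (suc v ∷ L) _ = [] , v , L , refl
positive-entry (zero ∷ L) 1≤ with positive-entry L 1≤
... | as , v , bs , refl = zero ∷ as , v , bs , refl

split-ends : ∀ {A : Set} (xs : List A) → 2 ≤ length xs → ∃[ w ] ∃[ es ] ∃[ u ] xs ≡ w ∷ es ∷ʳ u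
split-ends (_ ∷ [])         (s≤s ())
split-ends (w ∷ u ∷ [])     _ = w , [] , u , refl
split-ends (w ∷ d ∷ e ∷ ds) _ with split-ends (d ∷ e ∷ ds) (s≤s (s≤s z≤n))
... | d′ , es , u , eq = w , d′ ∷ es , u , cong (w ∷_) eq

contract-sum : ∀ u v w s → 1 + (u + v + w + s) ≡ u + (suc v + (w + s))
contract-sum = solve-∀

-- L′ merges a positive entry of L with its two neighbours.
CyclicallyCovered-shrink : ∀ L → CyclicallyCovered L → 3 ≤ length L →
  ∃[ L′ ] CyclicallyCovered L′ × 2 + length L′ ≡ length L × 1 + sum L′ ≡ sum L
CyclicallyCovered-shrink L cc 3≤ with positive-entry L (CyclicallyCovered⇒1≤sum L cc (≤-trans (s≤s z≤n) 3≤))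
... | as , v , bs , refl with split-ends (bs ++ as) (s≤s⁻¹ (≤-trans 3≤ (≤-reflexive (↭-length (++-comm as (suc v ∷ bs))))))
...   | w , es , u , eq =
  u + v + w ∷ es , cc′ , sym (↭-length centred) , trans (contract-sum u v w (sum es)) (sym (sum-↭ centred))
  where
  centred : as ++ suc v ∷ bs ↭ u ∷ suc v ∷ w ∷ es
  centred = ↭-trans (++-comm as (suc v ∷ bs))
              (subst (_↭ u ∷ suc v ∷ w ∷ es) (cong (suc v ∷_) (sym eq)) (++-comm (suc v ∷ w ∷ es) (u ∷ [])))
  cc′ : CyclicallyCovered (u + v + w ∷ es)
  cc′ = CyclicallyCovered-contract u v w es
          (CyclicallyCovered-rotate (suc v ∷ w ∷ es) (u ∷ [])
            (subst CyclicallyCovered (cong (suc v ∷_) eq) (CyclicallyCovered-rotate as (suc v ∷ bs) cc)))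

CyclicallyCovered⇒⌈length/2⌉≤sum : ∀ L → CyclicallyCovered L → ⌈ length L /2⌉ ≤ sum L
CyclicallyCovered⇒⌈length/2⌉≤sum L = bound (length L) L refl
  where
  bound : ∀ n L → length L ≡ n → CyclicallyCovered L → ⌈ n /2⌉ ≤ sum L
  bound 0                   L len cc = z≤n
  bound 1                   L len cc = CyclicallyCovered⇒1≤sum L cc (≤-reflexive (sym len))
  bound 2                   L len cc = CyclicallyCovered⇒1≤sum L cc (≤-trans (s≤s z≤n) (≤-reflexive (sym len)))
  bound (suc (suc (suc n))) L len cc =
    let L′ , cc′ , len′ , sum′ = CyclicallyCovered-shrink L cc (≤-trans (s≤s (s≤s (s≤s z≤n))) (≤-reflexive (sym len)))
    in subst (⌈ 3 + n /2⌉ ≤_) sum′ (s≤s (bound (suc n) L′ (suc-injective (suc-injective (trans len′ len))) cc′))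

-- Rubbling moves on a path

data PathMove : List ℕ → List ℕ → Set where
  forward  : ∀ {a b r}   → PathMove (suc (suc a) ∷ b ∷ r) (a ∷ suc b ∷ r)
  backward : ∀ {a b r}   → PathMove (a ∷ suc (suc b) ∷ r) (suc a ∷ b ∷ r)
  strict   : ∀ {a b c r} → PathMove (suc a ∷ b ∷ suc c ∷ r) (a ∷ suc b ∷ c ∷ r)
  there    : ∀ {a f g}   → PathMove f g → PathMove (a ∷ f) (a ∷ g)

PathMove-++ʳ : ∀ {f g} s → PathMove f g → PathMove (f ++ s) (g ++ s)
PathMove-++ʳ s forward    = forward
PathMove-++ʳ s backward   = backward
PathMove-++ʳ s strict     = strict
PathMove-++ʳ s (there mv) = there (PathMove-++ʳ s mv)

PathMove-++ˡ : ∀ {f g} s → PathMove f g → PathMove (s ++ f) (s ++ g)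
PathMove-++ˡ []      mv = mv
PathMove-++ˡ (x ∷ s) mv = there (PathMove-++ˡ s mv)

PathMove-reverse : ∀ {f g} → PathMove f g → PathMove (reverse f) (reverse g)
PathMove-reverse {suc (suc a) ∷ b ∷ r} forward
  rewrite reverse-++ (suc (suc a) ∷ b ∷ []) r | reverse-++ (a ∷ suc b ∷ []) r = PathMove-++ˡ (reverse r) backward
PathMove-reverse {a ∷ suc (suc b) ∷ r} backward
  rewrite reverse-++ (a ∷ suc (suc b) ∷ []) r | reverse-++ (suc a ∷ b ∷ []) r = PathMove-++ˡ (reverse r) forward
PathMove-reverse {suc a ∷ b ∷ suc c ∷ r} strict
  rewrite reverse-++ (suc a ∷ b ∷ suc c ∷ []) r | reverse-++ (a ∷ suc b ∷ c ∷ []) r = PathMove-++ˡ (reverse r) strict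
PathMove-reverse {a ∷ f} {.a ∷ g} (there mv)
  rewrite unfold-reverse a f | unfold-reverse a g = PathMove-++ʳ (a ∷ []) (PathMove-reverse mv)

⌊1+n/2⌋≤1+⌊n/2⌋ : ∀ n → ⌊ suc n /2⌋ ≤ suc ⌊ n /2⌋
⌊1+n/2⌋≤1+⌊n/2⌋ n = ⌊n/2⌋-mono (n≤1+n (suc n))

load-PathMove : ∀ {f g} → PathMove f g → load g ≤ load f
load-PathMove {suc (suc a) ∷ b ∷ r} forward =
  ≤-trans (+-monoʳ-≤ a (⌊1+n/2⌋≤1+⌊n/2⌋ (b + ⌊ load r /2⌋))) (≤-trans (≤-reflexive (+-suc a _)) (n≤1+n _))
load-PathMove {a ∷ suc (suc b) ∷ r} backward = ≤-reflexive (sym (+-suc a _))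
load-PathMove {suc a ∷ b ∷ suc c ∷ r} strict =
  ≤-trans (+-monoʳ-≤ a (≤-trans (⌊1+n/2⌋≤1+⌊n/2⌋ (b + ⌊ c + ⌊ load r /2⌋ /2⌋))
                                (s≤s (⌊n/2⌋-mono (+-monoʳ-≤ b (⌊n/2⌋-mono (n≤1+n (c + ⌊ load r /2⌋))))))))
          (≤-reflexive (+-suc a _))
load-PathMove {a ∷ f} (there mv) = +-monoʳ-≤ a (⌊n/2⌋-mono (load-PathMove mv))

PathMove⇒≼ : ∀ {f g} → PathMove f g → g ≼ f
PathMove⇒≼ mv = load-PathMove mv , load-PathMove (PathMove-reverse mv)

δ : ℕ → ℕ → ℕ
δ zero    zero    = 1
δ zero    (suc _) = 0
δ (suc _) zero    = 0
δ (suc i) (suc j) = δ i j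

δ-refl : ∀ i → δ i i ≡ 1
δ-refl zero    = refl
δ-refl (suc i) = δ-refl i

δ-≢ : ∀ {i j} → i ≢ j → δ i j ≡ 0
δ-≢ {zero}  {zero}  i≢j = contradiction refl i≢j
δ-≢ {zero}  {suc j} i≢j = refl
δ-≢ {suc i} {zero}  i≢j = refl
δ-≢ {suc i} {suc j} i≢j = δ-≢ (i≢j ∘ cong suc)

applyUpTo-cong : ∀ m (f g : ℕ → ℕ) → (∀ i → i < m → f i ≡ g i) → applyUpTo f m ≡ applyUpTo g m
applyUpTo-cong zero    f g eq = refl
applyUpTo-cong (suc m) f g eq = cong₂ _∷_ (eq 0 z<s) (applyUpTo-cong m (f ∘ suc) (g ∘ suc) (λ i i<m → eq (suc i) (s<s i<m)))

PathMove-applyUpTo-there : ∀ m (f g : ℕ → ℕ) → f 0 ≡ g 0 →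
  PathMove (applyUpTo (f ∘ suc) m) (applyUpTo (g ∘ suc) m) → PathMove (applyUpTo f (suc m)) (applyUpTo g (suc m))
PathMove-applyUpTo-there m f g f0≡g0 mv = subst (λ y → PathMove (applyUpTo f (suc m)) (y ∷ _)) f0≡g0 (there mv)

+0-injective : ∀ {m n} → m + 0 ≡ n + 0 → m ≡ n
+0-injective = +-cancelʳ-≡ 0 _ _

forward-move : ∀ m (f g : ℕ → ℕ) a → suc a < m → (∀ i → i < m → g i + 2 * δ i a ≡ f i + δ i (suc a)) →
  PathMove (applyUpTo f m) (applyUpTo g m)
forward-move (suc (suc m)) f g zero _ h =
  subst₂ PathMove (cong (_∷ applyUpTo (f ∘ suc) (suc m)) f0) (cong (g 0 ∷_) (cong₂ _∷_ g1 rest)) forward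
  where
  f0 : suc (suc (g 0)) ≡ f 0
  f0 = trans (+-comm 2 (g 0)) (trans (h 0 z<s) (+-identityʳ (f 0)))
  g1 : suc (f 1) ≡ g 1
  g1 = trans (+-comm 1 (f 1)) (trans (sym (h 1 (s<s z<s))) (+-identityʳ (g 1)))
  rest : applyUpTo (f ∘ suc ∘ suc) m ≡ applyUpTo (g ∘ suc ∘ suc) m
  rest = applyUpTo-cong m _ _ (λ i i<m → sym (+0-injective (h (2 + i) (s<s (s<s i<m)))))
forward-move (suc m) f g (suc a) (s<s a<m) h =
  PathMove-applyUpTo-there m f g (sym (+0-injective (h 0 z<s)))
    (forward-move m (f ∘ suc) (g ∘ suc) a a<m (λ i i<m → h (suc i) (s<s i<m)))

backward-move : ∀ m (f g : ℕ → ℕ) a → suc a < m → (∀ i → i < m → g i + 2 * δ i (suc a) ≡ f i + δ i a) →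
  PathMove (applyUpTo f m) (applyUpTo g m)
backward-move (suc (suc m)) f g zero _ h =
  subst₂ PathMove (cong (f 0 ∷_) (cong (_∷ applyUpTo (f ∘ suc ∘ suc) m) f1)) (cong₂ _∷_ g0 (cong (g 1 ∷_) rest)) backward
  where
  g0 : suc (f 0) ≡ g 0
  g0 = trans (+-comm 1 (f 0)) (trans (sym (h 0 z<s)) (+-identityʳ (g 0)))
  f1 : suc (suc (g 1)) ≡ f 1
  f1 = trans (+-comm 2 (g 1)) (trans (h 1 (s<s z<s)) (+-identityʳ (f 1)))
  rest : applyUpTo (f ∘ suc ∘ suc) m ≡ applyUpTo (g ∘ suc ∘ suc) m
  rest = applyUpTo-cong m _ _ (λ i i<m → sym (+0-injective (h (2 + i) (s<s (s<s i<m)))))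
backward-move (suc m) f g (suc a) (s<s a<m) h =
  PathMove-applyUpTo-there m f g (sym (+0-injective (h 0 z<s)))
    (backward-move m (f ∘ suc) (g ∘ suc) a a<m (λ i i<m → h (suc i) (s<s i<m)))

strict-move : ∀ m (f g : ℕ → ℕ) a → 2 + a < m → (∀ i → i < m → g i + δ i a + δ i (2 + a) ≡ f i + δ i (suc a)) →
  PathMove (applyUpTo f m) (applyUpTo g m)
strict-move (suc (suc (suc m))) f g zero _ h =
  subst₂ PathMove (cong₂ _∷_ f0 (cong (f 1 ∷_) (cong (_∷ applyUpTo (f ∘ suc ∘ suc ∘ suc) m) f2)))
                  (cong (g 0 ∷_) (cong₂ _∷_ g1 (cong (g 2 ∷_) rest))) strict
  where
  f0 : suc (g 0) ≡ f 0
  f0 = trans (+-comm 1 (g 0)) (trans (sym (+-identityʳ (g 0 + 1))) (trans (h 0 z<s) (+-identityʳ (f 0))))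
  g1 : suc (f 1) ≡ g 1
  g1 = trans (+-comm 1 (f 1)) (trans (sym (h 1 (s<s z<s))) (trans (+-identityʳ (g 1 + 0)) (+-identityʳ (g 1))))
  f2 : suc (g 2) ≡ f 2
  f2 = trans (+-comm 1 (g 2)) (trans (cong (_+ 1) (sym (+-identityʳ (g 2)))) (trans (h 2 (s<s (s<s z<s))) (+-identityʳ (f 2))))
  rest : applyUpTo (f ∘ suc ∘ suc ∘ suc) m ≡ applyUpTo (g ∘ suc ∘ suc ∘ suc) m
  rest = applyUpTo-cong m _ _ (λ i i<m →
           sym (+0-injective (trans (sym (+-identityʳ (g (3 + i) + 0))) (h (3 + i) (s<s (s<s (s<s i<m)))))))
strict-move (suc (suc zero)) f g zero (s<s (s<s ())) h
strict-move (suc m) f g (suc a) (s<s a<m) h =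
  PathMove-applyUpTo-there m f g (sym (+0-injective (trans (sym (+-identityʳ (g 0 + 0))) (h 0 z<s))))
    (strict-move m (f ∘ suc) (g ∘ suc) a a<m (λ i i<m → h (suc i) (s<s i<m)))

applyUpTo-+ : ∀ (h : ℕ → ℕ) a b → applyUpTo h (a + b) ≡ applyUpTo h a ++ applyUpTo (h ∘ (a +_)) b
applyUpTo-+ h zero    b = refl
applyUpTo-+ h (suc a) b = cong (h 0 ∷_) (applyUpTo-+ (h ∘ suc) a b)

applyUpTo≡++∷ : ∀ m (h : ℕ → ℕ) as y bs → applyUpTo h m ≡ as ++ y ∷ bs →
  ∃[ t ] t < m × as ≡ applyUpTo h t × y ≡ h t × bs ≡ applyUpTo (h ∘ (suc t +_)) (m ∸ suc t)
applyUpTo≡++∷ zero    h []       y bs ()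
applyUpTo≡++∷ zero    h (_ ∷ _)  y bs ()
applyUpTo≡++∷ (suc m) h []       y bs eq with ∷-injective eq
... | refl , refl = 0 , z<s , refl , refl , refl
applyUpTo≡++∷ (suc m) h (a ∷ as) y bs eq with ∷-injective eq
... | refl , eq′ with applyUpTo≡++∷ m (h ∘ suc) as y bs eq′
...   | t , t<m , refl , refl , refl = suc t , s<s t<m , refl , refl , refl

sum-applyUpTo : ∀ m (h : ℕ → ℕ) (f : Fin m → ℕ) → (∀ i → h (toℕ i) ≡ f i) → sum (applyUpTo h m) ≡ foldr _+_ 0 f
sum-applyUpTo zero    h f eq = refl
sum-applyUpTo (suc m) h f eq = cong₂ _+_ (eq F.zero) (sum-applyUpTo m (h ∘ suc) (f ∘ F.suc) (eq ∘ F.suc))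

𝟙-refl : ∀ {n} (x : Fin n) → 𝟙 x x ≡ 1
𝟙-refl x with x F.≟ x
... | yes _   = refl
... | no x≢x  = contradiction refl x≢x

𝟙-≢ : ∀ {n} {x y : Fin n} → x ≢ y → 𝟙 x y ≡ 0
𝟙-≢ {x = x} {y} x≢y with x F.≟ y
... | yes x≡y = contradiction x≡y x≢y
... | no _    = refl

+-cancel-zeros : ∀ {m n} r a → r ≡ 0 → a ≡ 0 → m + r ≡ n + a → m ≡ n
+-cancel-zeros r a refl refl eq = +0-injective eq

m+n≡o+0⇒n≤o : ∀ m {n o} → m + n ≡ o + 0 → n ≤ o
m+n≡o+0⇒n≤o m {n} {o} eq = ≤-trans (m≤n+m n m) (≤-reflexive (trans eq (+-identityʳ o)))

strict-reachable : ∀ G (p : Distribution G) {v w x} → v ≢ w → Adj G v x → Adj G w x → x ≢ v → x ≢ w →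
                   1 ≤ p v → 1 ≤ p w → Reachable G p x
strict-reachable G p {v} {w} {x} v≢w vx wx x≢v x≢w 1≤pv 1≤pw = q , strict v w x v≢w vx wx q-eq ◅ ε , 1≤qx
  where
  q : Distribution G
  q y = (p y + 𝟙 y x) ∸ (𝟙 y v + 𝟙 y w)
  removable : ∀ y → 𝟙 y v + 𝟙 y w ≤ p y + 𝟙 y x
  removable y with y F.≟ v | y F.≟ w
  ... | yes refl | yes refl = contradiction refl v≢w
  ... | yes refl | no _     = ≤-trans 1≤pv (m≤m+n (p y) _)
  ... | no _     | yes refl = ≤-trans 1≤pw (m≤m+n (p y) _)
  ... | no _     | no _     = z≤n
  q-eq : ∀ y → q y + 𝟙 y v + 𝟙 y w ≡ p y + 𝟙 y x
  q-eq y = trans (+-assoc (q y) (𝟙 y v) (𝟙 y w)) (m∸n+n≡m (removable y))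
  1≤qx : 1 ≤ q x
  1≤qx = subst (1 ≤_) (sym (cong₂ (λ a b → (p x + 𝟙 x x) ∸ (a + b)) (𝟙-≢ x≢v) (𝟙-≢ x≢w)))
           (subst (λ a → 1 ≤ p x + a) (sym (𝟙-refl x)) (m≤n+m 1 (p x)))

onEven : ℕ → ℕ
onEven 0             = 1
onEven 1             = 0
onEven (suc (suc n)) = onEven n

sum-onEven : ∀ m → sum (applyUpTo onEven m) ≡ ⌈ m /2⌉
sum-onOdd  : ∀ m → sum (applyUpTo (onEven ∘ suc) m) ≡ ⌊ m /2⌋
sum-onEven zero    = refl
sum-onEven (suc m) = cong suc (sum-onOdd m)
sum-onOdd  zero    = refl
sum-onOdd  (suc m) = sum-onEven m

onEven-neighbours : ∀ t → onEven t ≡ 0 → ∃[ t′ ] t ≡ suc t′ × onEven t′ ≡ 1 × onEven (suc t) ≡ 1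
onEven-neighbours 1             _  = 0 , refl , refl , refl
onEven-neighbours (suc (suc t)) eq with onEven-neighbours t eq
... | _ , _ , _ , onEven[1+t]≡1 = suc t , refl , onEven[1+t]≡1 , onEven[1+t]≡1

[m%d+n]%d≡[m+n]%d : ∀ m n d .{{_ : NonZero d}} → (m % d + n) % d ≡ (m + n) % d
[m%d+n]%d≡[m+n]%d m n d = begin
  (m % d + n) % d         ≡⟨ %-distribˡ-+ (m % d) n d ⟩
  (m % d % d + n % d) % d ≡⟨ cong (λ z → (z + n % d) % d) (m%n%n≡m%n m d) ⟩
  (m % d + n % d) % d     ≡⟨ sym (%-distribˡ-+ m n d) ⟩
  (m + n) % d             ∎
  where open ≡-Reasoning

[m+n%d]%d≡[m+n]%d : ∀ m n d .{{_ : NonZero d}} → (m + n % d) % d ≡ (m + n) % d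
[m+n%d]%d≡[m+n]%d m n d = begin
  (m + n % d) % d ≡⟨ cong (_% d) (+-comm m (n % d)) ⟩
  (n % d + m) % d ≡⟨ [m%d+n]%d≡[m+n]%d n m d ⟩
  (n + m) % d     ≡⟨ cong (_% d) (+-comm n m) ⟩
  (m + n) % d     ∎
  where open ≡-Reasoning

[m+d]%d≡m : ∀ {m d} .{{_ : NonZero d}} → m < d → (m + d) % d ≡ m
[m+d]%d≡m {m} {d} m<d = trans ([m+n]%n≡m%n m d) (m<n⇒m%n≡m m<d)

module OnCycle (k : ℕ) where

  N K : ℕ
  N = suc (suc k)
  K = suc k

  -- offset x y = (y - x - 1) mod N, the inverse of after x.
  after : Fin N → ℕ → Fin N
  after x i = (toℕ x + suc i) mod N

  offset : Fin N → Fin N → ℕ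
  offset x y = (toℕ y + (K ∸ toℕ x)) % N

  toℕ-after : ∀ x i → toℕ (after x i) ≡ (toℕ x + suc i) % N
  toℕ-after x i = toℕ-fromℕ< (m%n<n (toℕ x + suc i) N)

  toℕ-after-0 : ∀ x → toℕ (after x 0) ≡ suc (toℕ x) % N
  toℕ-after-0 x = trans (toℕ-after x 0) (cong (_% N) (+-comm (toℕ x) 1))

  toℕ+gap : ∀ x → toℕ x + (K ∸ toℕ x) ≡ K
  toℕ+gap x = m+[n∸m]≡n (s≤s⁻¹ (toℕ<n x))

  offset-after : ∀ x i → i < N → offset x (after x i) ≡ i
  offset-after x i i<N = begin
    (toℕ (after x i) + g) % N         ≡⟨ cong (λ z → (z + g) % N) (toℕ-after x i) ⟩
    ((toℕ x + suc i) % N + g) % N     ≡⟨ [m%d+n]%d≡[m+n]%d (toℕ x + suc i) g N ⟩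
    (toℕ x + suc i + g) % N           ≡⟨ cong (_% N) (rearrange (toℕ x) i g) ⟩
    (suc i + (toℕ x + g)) % N         ≡⟨ cong (λ z → (suc i + z) % N) (toℕ+gap x) ⟩
    (suc i + K) % N                   ≡⟨ cong (_% N) (sym (+-suc i K)) ⟩
    (i + N) % N                       ≡⟨ [m+d]%d≡m i<N ⟩
    i                                 ∎
    where
    open ≡-Reasoning
    g = K ∸ toℕ x
    rearrange : ∀ t i g → t + suc i + g ≡ suc i + (t + g)
    rearrange = solve-∀

  after-offset : ∀ x y → after x (offset x y) ≡ y
  after-offset x y = toℕ-injective (begin
    toℕ (after x (offset x y))            ≡⟨ toℕ-after x (offset x y) ⟩
    (toℕ x + suc ((toℕ y + g) % N)) % N   ≡⟨ cong (_% N) (+-suc (toℕ x) ((toℕ y + g) % N)) ⟩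
    (suc (toℕ x) + (toℕ y + g) % N) % N   ≡⟨ [m+n%d]%d≡[m+n]%d (suc (toℕ x)) (toℕ y + g) N ⟩
    (suc (toℕ x) + (toℕ y + g)) % N       ≡⟨ cong (_% N) (rearrange (toℕ x) (toℕ y) g) ⟩
    (toℕ y + suc (toℕ x + g)) % N         ≡⟨ cong (λ z → (toℕ y + suc z) % N) (toℕ+gap x) ⟩
    (toℕ y + N) % N                       ≡⟨ [m+d]%d≡m (toℕ<n y) ⟩
    toℕ y                                 ∎)
    where
    open ≡-Reasoning
    g = K ∸ toℕ x
    rearrange : ∀ t s g → suc t + (s + g) ≡ s + suc (t + g)
    rearrange = solve-∀

  offset-injective : ∀ x {y z} → offset x y ≡ offset x z → y ≡ z
  offset-injective x {y} {z} o = trans (sym (after-offset x y)) (trans (cong (after x) o) (after-offset x z))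

  after-K : ∀ x → after x K ≡ x
  after-K x = toℕ-injective (trans (toℕ-after x K) ([m+d]%d≡m (toℕ<n x)))

  offset<K : ∀ x y → y ≢ x → offset x y < K
  offset<K x y y≢x with m≤n⇒m<n∨m≡n (s≤s⁻¹ (m%n<n (toℕ y + (K ∸ toℕ x)) N))
  ... | inj₁ offset<K   = offset<K
  ... | inj₂ offset≡K = contradiction (trans (sym (after-offset x y)) (trans (cong (after x) offset≡K) (after-K x))) y≢x

  CycSucc⇒toℕ : ∀ {v u} → CycSucc N v u → toℕ u ≡ suc (toℕ v) % N
  CycSucc⇒toℕ {v} {u} (inj₁ 1+v≡u)         = sym (trans (cong (_% N) 1+v≡u) (m<n⇒m%n≡m (toℕ<n u)))
  CycSucc⇒toℕ         (inj₂ (1+v≡N , u≡0)) = trans u≡0 (sym (trans (cong (_% N) 1+v≡N) (n%n≡0 N)))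

  offset-CycSucc : ∀ x {v u} → CycSucc N v u → v ≢ x → offset x u ≡ suc (offset x v)
  offset-CycSucc x {v} {u} s v≢x = begin
    (toℕ u + g) % N               ≡⟨ cong (λ z → (z + g) % N) (CycSucc⇒toℕ s) ⟩
    (suc (toℕ v) % N + g) % N     ≡⟨ [m%d+n]%d≡[m+n]%d (suc (toℕ v)) g N ⟩
    suc (toℕ v + g) % N           ≡⟨ sym ([m+n%d]%d≡[m+n]%d 1 (toℕ v + g) N) ⟩
    suc (offset x v) % N          ≡⟨ m<n⇒m%n≡m (s≤s (offset<K x v v≢x)) ⟩
    suc (offset x v)              ∎
    where
    open ≡-Reasoning
    g = K ∸ toℕ x

  CycSucc⇒after-0 : ∀ {x v} → CycSucc N x v → v ≡ after x 0
  CycSucc⇒after-0 {x} s = toℕ-injective (trans (CycSucc⇒toℕ s) (sym (toℕ-after-0 x)))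

  CycSucc-irrefl : ∀ {v} → ¬ CycSucc N v v
  CycSucc-irrefl (inj₁ 1+v≡v)          = 1+n≢n 1+v≡v
  CycSucc-irrefl (inj₂ (1+v≡N , v≡0)) with trans (sym 1+v≡N) (cong suc v≡0)
  ... | ()

  CycSucc⇒≢ : ∀ {v u} → CycSucc N v u → v ≢ u
  CycSucc⇒≢ s refl = CycSucc-irrefl s

  CycleAdj-irrefl : ∀ {v} → ¬ CycleAdj N v v
  CycleAdj-irrefl (inj₁ s) = CycSucc-irrefl s
  CycleAdj-irrefl (inj₂ s) = CycSucc-irrefl s

  offset-self : ∀ x → offset x x ≡ K
  offset-self x = trans (cong (_% N) (toℕ+gap x)) (m<n⇒m%n≡m (n<1+n K))

  CycSucc⇒after-k : ∀ {x v} → CycSucc N v x → v ≡ after x k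
  CycSucc⇒after-k {x} {v} s = trans (sym (after-offset x v)) (cong (after x) offset≡k)
    where
    offset≡k : offset x v ≡ k
    offset≡k = suc-injective (trans (sym (offset-CycSucc x s (CycSucc⇒≢ s))) (offset-self x))

  𝟙-after : ∀ x i y → i < K → y ≢ x → 𝟙 (after x i) y ≡ δ i (offset x y)
  𝟙-after x i y i<K y≢x with i ≟ offset x y
  ... | yes refl = trans (cong (𝟙 (after x i)) (sym (after-offset x y))) (trans (𝟙-refl _) (sym (δ-refl i)))
  ... | no i≢j   = trans (𝟙-≢ after-i≢y) (sym (δ-≢ i≢j))
    where
    after-i≢y : after x i ≢ y
    after-i≢y eq = i≢j (trans (sym (offset-after x i (m<n⇒m<1+n i<K))) (cong (offset x) eq))

  -- Lower bound

  arm : (Fin N → ℕ) → Fin N → List ℕ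
  arm p x = applyUpTo (p ∘ after x) K

  CoveredAt : (Fin N → ℕ) → Fin N → Set
  CoveredAt p x = Covered (p x) (arm p x)

  neighbour : ∀ {v x} → CycleAdj N v x → v ≡ after x 0 ⊎ v ≡ after x k
  neighbour (inj₁ s) = inj₂ (CycSucc⇒after-k s)
  neighbour (inj₂ s) = inj₁ (CycSucc⇒after-0 s)

  p-after-0≤load : ∀ p x → p (after x 0) ≤ load (arm p x)
  p-after-0≤load p x = m≤m+n _ _

  p-after-k≤load-reverse : ∀ p x → p (after x k) ≤ load (reverse (arm p x))
  p-after-k≤load-reverse p x = subst (λ xs → p (after x k) ≤ load xs) (sym (reverse-applyUpTo (p ∘ after x) K)) (m≤m+n _ _)

  Suffices-one-neighbour : ∀ p {x v} → CycleAdj N v x → 2 ≤ p v → Suffices (load (arm p x)) (load (reverse (arm p x)))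
  Suffices-one-neighbour p {x} adj 2≤pv with neighbour adj
  ... | inj₁ refl = inj₁ (≤-trans 2≤pv (p-after-0≤load p x))
  ... | inj₂ refl = inj₂ (inj₁ (≤-trans 2≤pv (p-after-k≤load-reverse p x)))

  Suffices-two-neighbours : ∀ p {x v w} → v ≢ w → CycleAdj N v x → CycleAdj N w x → 1 ≤ p v → 1 ≤ p w →
                            Suffices (load (arm p x)) (load (reverse (arm p x)))
  Suffices-two-neighbours p {x} v≢w av aw 1≤pv 1≤pw with neighbour av | neighbour aw
  ... | inj₁ refl | inj₁ refl = contradiction refl v≢w
  ... | inj₁ refl | inj₂ refl = inj₂ (inj₂ (≤-trans 1≤pv (p-after-0≤load p x) , ≤-trans 1≤pw (p-after-k≤load-reverse p x)))
  ... | inj₂ refl | inj₁ refl = inj₂ (inj₂ (≤-trans 1≤pw (p-after-0≤load p x) , ≤-trans 1≤pv (p-after-k≤load-reverse p x)))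
  ... | inj₂ refl | inj₂ refl = contradiction refl v≢w

  CoveredAt-untouched : ∀ p q x → PathMove (arm p x) (arm q x) → q x ≡ p x → CoveredAt q x → CoveredAt p x
  CoveredAt-untouched p q x mv qx≡px cov =
    Covered-mono {xs = arm q x} {ys = arm p x} (PathMove⇒≼ mv) (subst (λ y → Covered y (arm q x)) qx≡px cov)

  pebbling-source : ∀ (p q : Fin N → ℕ) {v u} → v ≢ u → q v + 2 * 𝟙 v v ≡ p v + 𝟙 v u → 2 ≤ p v
  pebbling-source p q {v} v≢u eq =
    m+n≡o+0⇒n≤o (q v) (subst₂ (λ a b → q v + 2 * a ≡ p v + b) (𝟙-refl v) (𝟙-≢ v≢u) eq)

  strict-source : ∀ (p q : Fin N → ℕ) {y u} r → y ≢ u → q y + r + 𝟙 y y ≡ p y + 𝟙 y u → 1 ≤ p y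
  strict-source p q {y} r y≢u eq =
    m+n≡o+0⇒n≤o (q y + r) (subst₂ (λ a b → q y + r + a ≡ p y + b) (𝟙-refl y) (𝟙-≢ y≢u) eq)

  pebbling-PathMove : ∀ (p q : Fin N → ℕ) x {v u} → CycleAdj N v u → v ≢ x → u ≢ x →
                      (∀ y → q y + 2 * 𝟙 y v ≡ p y + 𝟙 y u) → PathMove (arm p x) (arm q x)
  pebbling-PathMove p q x {v} {u} adj v≢x u≢x eq = move adj
    where
    arm-eq : ∀ i → i < K → q (after x i) + 2 * δ i (offset x v) ≡ p (after x i) + δ i (offset x u)
    arm-eq i i<K = subst₂ (λ a b → q (after x i) + 2 * a ≡ p (after x i) + b)
                     (𝟙-after x i v i<K v≢x) (𝟙-after x i u i<K u≢x) (eq (after x i))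
    move : CycleAdj N v u → PathMove (arm p x) (arm q x)
    move (inj₁ s) =
      forward-move K (p ∘ after x) (q ∘ after x) (offset x v) (subst (_< K) o (offset<K x u u≢x))
        (subst (λ b → ∀ i → i < K → q (after x i) + 2 * δ i (offset x v) ≡ p (after x i) + δ i b) o arm-eq)
      where o = offset-CycSucc x s v≢x
    move (inj₂ s) =
      backward-move K (p ∘ after x) (q ∘ after x) (offset x u) (subst (_< K) o (offset<K x v v≢x))
        (subst (λ a → ∀ i → i < K → q (after x i) + 2 * δ i a ≡ p (after x i) + δ i (offset x u)) o arm-eq)
      where o = offset-CycSucc x s u≢x

  strict-PathMove : ∀ (p q : Fin N → ℕ) x {a b u} → CycSucc N a u → CycSucc N u b → a ≢ x → u ≢ x → b ≢ x →
                    (∀ y → q y + 𝟙 y a + 𝟙 y b ≡ p y + 𝟙 y u) → PathMove (arm p x) (arm q x)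
  strict-PathMove p q x {a} {b} {u} au ub a≢x u≢x b≢x eq =
    strict-move K (p ∘ after x) (q ∘ after x) (offset x a) (subst (_< K) ob (offset<K x b b≢x)) arm-eq
    where
    ou : offset x u ≡ suc (offset x a)
    ou = offset-CycSucc x au a≢x
    ob : offset x b ≡ 2 + offset x a
    ob = trans (offset-CycSucc x ub u≢x) (cong suc ou)
    arm-eq : ∀ i → i < K →
             q (after x i) + δ i (offset x a) + δ i (2 + offset x a) ≡ p (after x i) + δ i (suc (offset x a))
    arm-eq i i<K =
      subst₂ (λ c d → q (after x i) + δ i (offset x a) + c ≡ p (after x i) + d)
        (trans (𝟙-after x i b i<K b≢x) (cong (δ i) ob)) (trans (𝟙-after x i u i<K u≢x) (cong (δ i) ou))
        (subst (λ c → q (after x i) + c + 𝟙 (after x i) b ≡ p (after x i) + 𝟙 (after x i) u)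
          (𝟙-after x i a i<K a≢x) (eq (after x i)))

  CoveredAt-pebbling : ∀ p q x v u → CycleAdj N v u → (∀ y → q y + 2 * 𝟙 y v ≡ p y + 𝟙 y u) →
                       CoveredAt q x → CoveredAt p x
  CoveredAt-pebbling p q x v u adj eq cov with x F.≟ v | x F.≟ u
  ... | yes refl | _        = inj₁ (≤-trans (s≤s z≤n) (pebbling-source p q (λ { refl → CycleAdj-irrefl adj }) (eq x)))
  ... | no x≢v   | yes refl = inj₂ (Suffices-one-neighbour p adj (pebbling-source p q (≢-sym x≢v) (eq v)))
  ... | no x≢v   | no x≢u   =
    CoveredAt-untouched p q x (pebbling-PathMove p q x adj (≢-sym x≢v) (≢-sym x≢u) eq)
      (+-cancel-zeros (2 * 𝟙 x v) (𝟙 x u) (cong (2 *_) (𝟙-≢ x≢v)) (𝟙-≢ x≢u) (eq x)) cov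

  CoveredAt-strict : ∀ p q x v w u → v ≢ w → CycleAdj N v u → CycleAdj N w u →
                     (∀ y → q y + 𝟙 y v + 𝟙 y w ≡ p y + 𝟙 y u) → CoveredAt q x → CoveredAt p x
  CoveredAt-strict p q x v w u v≢w av aw eq cov with x F.≟ v | x F.≟ w | x F.≟ u
  ... | yes refl | _        | _        =
    inj₁ (strict-source p q (𝟙 x w) (λ { refl → CycleAdj-irrefl av }) (trans (xy∙z≈xz∙y (q x) (𝟙 x w) (𝟙 x x)) (eq x)))
  ... | no _     | yes refl | _        = inj₁ (strict-source p q (𝟙 x v) (λ { refl → CycleAdj-irrefl aw }) (eq x))
  ... | no x≢v   | no x≢w   | yes refl = inj₂ (Suffices-two-neighbours p v≢w av aw
        (strict-source p q (𝟙 v w) (≢-sym x≢v) (trans (xy∙z≈xz∙y (q v) (𝟙 v w) (𝟙 v v)) (eq v)))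
        (strict-source p q (𝟙 w v) (≢-sym x≢w) (eq w)))
  ... | no x≢v   | no x≢w   | no x≢u   =
    CoveredAt-untouched p q x (move av aw)
      (+-cancel-zeros (𝟙 x v + 𝟙 x w) (𝟙 x u) (cong₂ _+_ (𝟙-≢ x≢v) (𝟙-≢ x≢w)) (𝟙-≢ x≢u)
        (trans (sym (+-assoc (q x) (𝟙 x v) (𝟙 x w))) (eq x))) cov
    where
    move : CycleAdj N v u → CycleAdj N w u → PathMove (arm p x) (arm q x)
    move (inj₁ s) (inj₂ t) = strict-PathMove p q x s t (≢-sym x≢v) (≢-sym x≢u) (≢-sym x≢w) eq
    move (inj₂ s) (inj₁ t) = strict-PathMove p q x t s (≢-sym x≢w) (≢-sym x≢u) (≢-sym x≢v)
                               (λ y → trans (xy∙z≈xz∙y (q y) (𝟙 y w) (𝟙 y v)) (eq y))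
    move (inj₁ s) (inj₁ t) = contradiction (offset-injective x
                               (suc-injective (trans (sym (offset-CycSucc x s (≢-sym x≢v)))
                                                     (offset-CycSucc x t (≢-sym x≢w))))) v≢w
    move (inj₂ s) (inj₂ t) = contradiction (offset-injective x
                               (trans (offset-CycSucc x s (≢-sym x≢u)) (sym (offset-CycSucc x t (≢-sym x≢u))))) v≢w

  CoveredAt-Move : ∀ {p q} x → Move (Cycle N) p q → CoveredAt q x → CoveredAt p x
  CoveredAt-Move {p} {q} x (pebbling v u adj eq)        = CoveredAt-pebbling p q x v u adj eq
  CoveredAt-Move {p} {q} x (strict v w u v≢w av aw eq) = CoveredAt-strict p q x v w u v≢w av aw eq

  Reachable⇒CoveredAt : ∀ p x → Reachable (Cycle N) p x → CoveredAt p x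
  Reachable⇒CoveredAt p x (q , moves , 1≤qx) = backwards moves
    where
    backwards : ∀ {r} → Star (Move (Cycle N)) r q → CoveredAt r x
    backwards ε          = inj₁ 1≤qx
    backwards (mv ◅ mvs) = CoveredAt-Move x mv (backwards mvs)

  toℕ-mod : ∀ i → i < N → toℕ (i mod N) ≡ i
  toℕ-mod i i<N = trans (toℕ-fromℕ< (m%n<n i N)) (m<n⇒m%n≡m i<N)

  [N+i]mod-N : ∀ i → (N + i) mod N ≡ i mod N
  [N+i]mod-N i = toℕ-injective (begin
    toℕ ((N + i) mod N) ≡⟨ toℕ-fromℕ< (m%n<n (N + i) N) ⟩
    (N + i) % N         ≡⟨ cong (_% N) (+-comm N i) ⟩
    (i + N) % N         ≡⟨ [m+n]%n≡m%n i N ⟩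
    i % N               ≡⟨ sym (toℕ-fromℕ< (m%n<n i N)) ⟩
    toℕ (i mod N)       ∎)
    where open ≡-Reasoning

  cyclic : (Fin N → ℕ) → List ℕ
  cyclic p = applyUpTo (p ∘ (_mod N)) N

  sum-cyclic : ∀ p → sum (cyclic p) ≡ size (Cycle N) p
  sum-cyclic p = sum-applyUpTo N (p ∘ (_mod N)) p (λ i → cong p (toℕ-injective (toℕ-mod (toℕ i) (toℕ<n i))))

  arm-mod : ∀ p t → t < N →
            arm p (t mod N) ≡ applyUpTo (p ∘ (_mod N) ∘ (suc t +_)) (N ∸ suc t) ++ applyUpTo (p ∘ (_mod N)) t
  arm-mod p t t<N = begin
    applyUpTo (p ∘ after (t mod N)) K
      ≡⟨ cong (applyUpTo (p ∘ after (t mod N))) (sym (m∸n+n≡m (s≤s⁻¹ t<N))) ⟩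
    applyUpTo (p ∘ after (t mod N)) (a + t)
      ≡⟨ applyUpTo-+ (p ∘ after (t mod N)) a t ⟩
    applyUpTo (p ∘ after (t mod N)) a ++ applyUpTo (p ∘ after (t mod N) ∘ (a +_)) t
      ≡⟨ cong₂ _++_ (applyUpTo-cong a _ _ (λ i _ → cong p (cong (_mod N) (before i))))
                    (applyUpTo-cong t _ _ (λ i _ → cong p (trans (cong (_mod N) (wrapped i)) ([N+i]mod-N i)))) ⟩
    applyUpTo (p ∘ (_mod N) ∘ (suc t +_)) a ++ applyUpTo (p ∘ (_mod N)) t
      ∎
    where
    open ≡-Reasoning
    a = N ∸ suc t
    before : ∀ i → toℕ (t mod N) + suc i ≡ suc t + i
    before i = trans (cong (_+ suc i) (toℕ-mod t t<N)) (+-suc t i)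
    wrapped : ∀ i → toℕ (t mod N) + suc (a + i) ≡ N + i
    wrapped i = trans (before (a + i)) (trans (sym (+-assoc (suc t) a i)) (cong (_+ i) (m+[n∸m]≡n t<N)))

  cyclic-CyclicallyCovered : ∀ p → (∀ x → CoveredAt p x) → CyclicallyCovered (cyclic p)
  cyclic-CyclicallyCovered p cov as y bs eq with applyUpTo≡++∷ N (p ∘ (_mod N)) as y bs eq
  ... | t , t<N , refl , refl , refl = subst (Covered (p (t mod N))) (arm-mod p t t<N) (cov (t mod N))

  size-lower-bound : ∀ p → Solvable (Cycle N) p → ⌈ N /2⌉ ≤ size (Cycle N) p
  size-lower-bound p solvable =
    subst (⌈ N /2⌉ ≤_) (sum-cyclic p)
      (subst (λ n → ⌈ n /2⌉ ≤ sum (cyclic p)) (length-applyUpTo (p ∘ (_mod N)) N)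
        (CyclicallyCovered⇒⌈length/2⌉≤sum (cyclic p)
          (cyclic-CyclicallyCovered p (λ x → Reachable⇒CoveredAt p x (solvable x)))))

  -- Upper bound

  CycSucc-after-0 : ∀ x → CycSucc N x (after x 0)
  CycSucc-after-0 x with m≤n⇒m<n∨m≡n (toℕ<n x)
  ... | inj₁ 1+x<N = inj₁ (sym (trans (toℕ-after-0 x) (m<n⇒m%n≡m 1+x<N)))
  ... | inj₂ 1+x≡N = inj₂ (1+x≡N , trans (toℕ-after-0 x) (trans (cong (_% N) 1+x≡N) (n%n≡0 N)))

  after-0≢after-k : 1 ≤ k → ∀ x → after x 0 ≢ after x k
  after-0≢after-k 1≤k x eq = <⇒≢ 1≤k (begin
    0                     ≡⟨ sym (offset-after x 0 z<s) ⟩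
    offset x (after x 0)  ≡⟨ cong (offset x) eq ⟩
    offset x (after x k)  ≡⟨ offset-after x k (m<n⇒m<1+n (n<1+n k)) ⟩
    k                     ∎)
    where open ≡-Reasoning

  alternating : Fin N → ℕ
  alternating v = onEven (toℕ v)

  size-alternating : size (Cycle N) alternating ≡ ⌈ N /2⌉
  size-alternating = trans (sym (sum-applyUpTo N onEven alternating (λ _ → refl))) (sum-onEven N)

  alternating-solvable : 1 ≤ k → Solvable (Cycle N) alternating
  alternating-solvable 1≤k x with onEven (toℕ x) in ex
  ... | suc _ = alternating , ε , subst (1 ≤_) (sym ex) (s≤s z≤n)
  ... | zero with onEven-neighbours (toℕ x) ex
  ...   | t , x≡1+t , onEven-t≡1 , onEven-1+x≡1 =
    strict-reachable (Cycle N) alternating v≢w (inj₁ vx) (inj₂ xw) (≢-sym (CycSucc⇒≢ vx)) (CycSucc⇒≢ xw)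
      (≤-reflexive (sym (trans (cong onEven (toℕ-fromℕ< t<N)) onEven-t≡1))) 1≤pw
    where
    t<N : t < N
    t<N = ≤-trans (n<1+n t) (≤-trans (≤-reflexive (sym x≡1+t)) (<⇒≤ (toℕ<n x)))
    v w : Fin N
    v = F.fromℕ< t<N
    w = after x 0
    vx : CycSucc N v x
    vx = inj₁ (trans (cong suc (toℕ-fromℕ< t<N)) (sym x≡1+t))
    xw : CycSucc N x w
    xw = CycSucc-after-0 x
    v≢w : v ≢ w
    v≢w v≡w = after-0≢after-k 1≤k x (trans (sym v≡w) (CycSucc⇒after-k vx))
    1≤pw : 1 ≤ alternating w
    1≤pw with xw
    ... | inj₁ 1+x≡w      = ≤-reflexive (sym (trans (cong onEven (sym 1+x≡w)) onEven-1+x≡1))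
    ... | inj₂ (_ , w≡0) = ≤-reflexive (sym (cong onEven w≡0))

mainTheorem17 : (k : ℕ) → k ≥ 3 → IsOptRubblingNumber (Cycle k) ⌈ k /2⌉
mainTheorem17 (suc (suc (suc k))) (s≤s (s≤s (s≤s _))) =
  (alternating , size-alternating , alternating-solvable (s≤s z≤n)) , size-lower-bound
  where open OnCycle (suc k)
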